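{- Consider integers $n\ge 0$, $l\ge 1$ and $b$ with $2 \leq b \leq 10$. \begin{enumerate} \item The solutions $(n,b,l)$ of $E_{n} = (b+1)b^l-1$ are exactly $(5,2,1), (6,2,1), (12,5,1)$; thus the Thabit numbers of the first kind base $b$ which are Perrin numbers are $5$ and $29$. \item The only solution $(n,b,l)$ of $E_{n} = (b+1)b^l+1$ is $(7,2,1)$; thus the only Thabit number of the second kind base $b$ which is a Perrin number is $7$. \item The solutions $(n,b,l)$ of $E_{n} = (b-1)b^l-1$ are exactly $(0,2,2), (3,2,2), (5,3,1), (6,3,1), (7,2,3), (10,3,2), (12,6,1)$; thus the Williams numbers of the first kind base $b$ which are Perrin numbers are $3, 5, 7, 17, 29$. \item The solutions $(n,b,l)$ of $E_{n} = (b-1)b^l+1$ are exactly $(0,2,1), (3,2,1), (5,2,2), (6,2,2), (7,3,1), (10,2,4)$; thus the Williams numbers of the second kind base $b$ which are Perrin numbers are $3, 5, 7, 17$. \end{enumerate}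
   Context: $(E_n)_{n\ge 0}$ denotes the Perrin sequence: $E_0=3$, $E_1=0$, $E_2=2$ and $E_{n+3}=E_{n+1}+E_n$ for all $n\ge 0$. For an integer $b\ge 2$ and $l\ge 1$: a Thabit number of the first kind base $b$ is $(b+1)b^l-1$, of the second kind is $(b+1)b^l+1$; a Williams number of the first kind base $b$ is $(b-1)b^l-1$, of the second kind is $(b-1)b^l+1$. -}

module Defs where

open import Data.Nat using (ℕ; zero; suc; _+_; _*_; _∸_; _^_; _≤_)
open import Data.Product using (_×_; ∃-syntax)
open import Data.Sum using (_⊎_)
open import Relation.Binary.PropositionalEquality using (_≡_)

E : ℕ → ℕ
E 0 = 3
E 1 = 0
E 2 = 2
E (suc (suc (suc n))) = E (suc n) + E n

thabit₁ thabit₂ williams₁ williams₂ : ℕ → ℕ → ℕ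
thabit₁ b l = (b + 1) * b ^ l ∸ 1
thabit₂ b l = (b + 1) * b ^ l + 1
williams₁ b l = (b ∸ 1) * b ^ l ∸ 1
williams₂ b l = (b ∸ 1) * b ^ l + 1

Adm : ℕ → ℕ → Set
Adm b l = (2 ≤ b × b ≤ 10) × 1 ≤ l

PerrinValue : (ℕ → ℕ → ℕ) → ℕ → Set
PerrinValue F m = ∃[ n ] ∃[ b ] ∃[ l ] (Adm b l × E n ≡ m × m ≡ F b l)

Triple : ℕ → ℕ → ℕ → ℕ → ℕ → ℕ → Set
Triple n b l n' b' l' = n ≡ n' × b ≡ b' × l ≡ l'

{-# OPTIONS --safe #-}
module Submission where

-- Fix a family and a base b, and write the equation as E n + d₁ = c·b^l + d₂.
-- For l at least a threshold L the equation is impossible modulo a suitable M: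
-- E n mod M is periodic in n (period P) and b^l mod M is periodic for l ≥ L
-- (period Q), so one full period of each side shows that the residues of the
-- two sides never meet. For 1 ≤ l < L the right-hand side is smaller than
-- the three consecutive Perrin numbers E 25, E 26, E 27, hence, by the
-- recurrence, smaller than every later one; this forces n < 25, and the
-- remaining cases are searched exhaustively. All of these finite checks are
-- carried out by evaluation.

open import Defs
open import Data.Bool.Base using (Bool; true; false; not; if_then_else_)
open import Data.Bool.ListAction using (all)
open import Data.Bool.Properties using (∧-conicalˡ; ∧-conicalʳ; not-¬; T-≡)
import Data.Bool.Properties as Bool
import Data.List.Base as List
open import Data.List.Base using (map; foldr)
open import Data.Nat.Base
open import Data.Nat.DivMod
open import Data.Nat.GeneralisedArithmetic using (iterate)
open import Data.Nat.Properties
open import Data.Product.Base using (_×_; _,_; proj₁)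
open import Data.Product.Properties using (≡-dec)
open import Data.Sum.Base using (_⊎_; inj₁; inj₂)
open import Function.Bundles using (_⇔_; mk⇔; Equivalence)
open import Relation.Binary.PropositionalEquality
open import Relation.Nullary.Decidable
  using (Dec; yes; no; isYes; True; toWitness; _×-dec_; _⊎-dec_; _→-dec_)
open import Relation.Nullary.Negation using (contradiction)

module _ {A : Set} (f : A → A) where

  iterate-suc : ∀ x n → iterate f x (suc n) ≡ f (iterate f x n)
  iterate-suc x zero    = refl
  iterate-suc x (suc n) = iterate-suc (f x) n

  iterate-+ : ∀ x m n → iterate f x (m + n) ≡ iterate f (iterate f x m) n
  iterate-+ x zero    n = refl
  iterate-+ x (suc m) n = iterate-+ (f x) m n

  iterate-periodic : ∀ {x P} → iterate f x P ≡ x → ∀ q → iterate f x (q * P) ≡ x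
  iterate-periodic         fix zero    = refl
  iterate-periodic {x} {P} fix (suc q) = begin
    iterate f x (P + q * P)           ≡⟨ iterate-+ x P (q * P) ⟩
    iterate f (iterate f x P) (q * P) ≡⟨ cong (λ y → iterate f y (q * P)) fix ⟩
    iterate f x (q * P)               ≡⟨ iterate-periodic fix q ⟩
    x                                 ∎
    where open ≡-Reasoning

  iterate-% : ∀ {x P} ⦃ _ : NonZero P ⦄ → iterate f x P ≡ x →
              ∀ n → iterate f x n ≡ iterate f x (n % P)
  iterate-% {x} {P} fix n = begin
    iterate f x n                               ≡⟨ cong (iterate f x) n≡[n/P]*P+n%P ⟩
    iterate f x (n / P * P + n % P)             ≡⟨ iterate-+ x (n / P * P) (n % P) ⟩
    iterate f (iterate f x (n / P * P)) (n % P) ≡⟨ cong (λ y → iterate f y (n % P))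
                                                        (iterate-periodic fix (n / P)) ⟩
    iterate f x (n % P)                         ∎
    where
      open ≡-Reasoning
      n≡[n/P]*P+n%P : n ≡ n / P * P + n % P
      n≡[n/P]*P+n%P = trans (m≡m%n+[m/n]*n n P) (+-comm (n % P) _)

  all-iterate : ∀ (p : A → Bool) x n → all p (List.iterate f x n) ≡ true →
                ∀ {i} → i < n → p (iterate f x i) ≡ true
  all-iterate p x (suc n) ok {zero}  _         = ∧-conicalˡ _ _ ok
  all-iterate p x (suc n) ok {suc i} (s≤s i<n) = all-iterate p (f x) n (∧-conicalʳ _ _ ok) i<n

  all-periodic-orbit : ∀ (p : A → Bool) {x P} ⦃ _ : NonZero P ⦄ →
                       iterate f x P ≡ x → all p (List.iterate f x P) ≡ true →
                       ∀ n → p (iterate f x n) ≡ true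
  all-periodic-orbit p {x} {P} fix ok n =
    trans (cong p (iterate-% fix n)) (all-iterate p x P ok (m%n<n n P))

-- A plain search tree, used only through the Boolean test `member`: the sieve
-- evaluates it on both sides of the equation, so no invariant is ever needed
-- (and it evaluates much faster than Data.Tree.AVL.Sets).
data Tree : Set where
  leaf : Tree
  node : Tree → ℕ → Tree → Tree

insert : ℕ → Tree → Tree
insert x leaf         = node leaf x leaf
insert x (node l y r) =
  if x <ᵇ y then node (insert x l) y r else if y <ᵇ x then node l y (insert x r) else node l y r

member : ℕ → Tree → Bool
member x leaf         = false
member x (node l y r) = if x <ᵇ y then member x l else if y <ᵇ x then member x r else true

module Sieve (M : ℕ) ⦃ _ : NonZero M ⦄ where

  [m%d+n]%d≡[m+n]%d : ∀ m n → (m % M + n) % M ≡ (m + n) % M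
  [m%d+n]%d≡[m+n]%d m n = begin
    (m % M + n) % M         ≡⟨ %-distribˡ-+ (m % M) n M ⟩
    (m % M % M + n % M) % M ≡⟨ cong (λ x → (x + n % M) % M) (m%n%n≡m%n m M) ⟩
    (m % M + n % M) % M     ≡⟨ %-distribˡ-+ m n M ⟨
    (m + n) % M             ∎
    where open ≡-Reasoning

  [m*[n%d]]%d≡[m*n]%d : ∀ m n → (m * (n % M)) % M ≡ (m * n) % M
  [m*[n%d]]%d≡[m*n]%d m n = begin
    (m * (n % M)) % M         ≡⟨ %-distribˡ-* m (n % M) M ⟩
    (m % M * (n % M % M)) % M ≡⟨ cong (λ x → (m % M * x) % M) (m%n%n≡m%n n M) ⟩
    (m % M * (n % M)) % M     ≡⟨ %-distribˡ-* m n M ⟨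
    (m * n) % M               ∎
    where open ≡-Reasoning

  perrinStep : ℕ × ℕ × ℕ → ℕ × ℕ × ℕ
  perrinStep (x , y , z) = y , z , (y + x) % M

  perrinWindow : ℕ → ℕ × ℕ × ℕ
  perrinWindow n = E n % M , E (suc n) % M , E (suc (suc n)) % M

  iterate-perrinStep : ∀ n → iterate perrinStep (perrinWindow 0) n ≡ perrinWindow n
  iterate-perrinStep zero    = refl
  iterate-perrinStep (suc n) = begin
    iterate perrinStep (perrinWindow 0) (suc n)        ≡⟨ iterate-suc perrinStep _ n ⟩
    perrinStep (iterate perrinStep (perrinWindow 0) n) ≡⟨ cong perrinStep (iterate-perrinStep n) ⟩
    perrinStep (perrinWindow n)                        ≡⟨ cong (λ r → E (suc n) % M , E (suc (suc n)) % M , r)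
                                                            (%-distribˡ-+ (E (suc n)) (E n) M) ⟨
    perrinWindow (suc n)                               ∎
    where open ≡-Reasoning

  powerStep : ℕ → ℕ → ℕ
  powerStep b x = b * x % M

  iterate-powerStep : ∀ b L k → iterate (powerStep b) (b ^ L % M) k ≡ b ^ (k + L) % M
  iterate-powerStep b L zero    = refl
  iterate-powerStep b L (suc k) = begin
    iterate (powerStep b) (b ^ L % M) (suc k)         ≡⟨ iterate-suc (powerStep b) _ k ⟩
    powerStep b (iterate (powerStep b) (b ^ L % M) k) ≡⟨ cong (powerStep b) (iterate-powerStep b L k) ⟩
    b * (b ^ (k + L) % M) % M                         ≡⟨ [m*[n%d]]%d≡[m*n]%d b (b ^ (k + L)) ⟩
    b ^ (suc k + L) % M                               ∎
    where open ≡-Reasoning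

  residueTree : (b c d₂ L Q : ℕ) → Tree
  residueTree b c d₂ L Q =
    foldr insert leaf (map (λ x → (c * x + d₂) % M) (List.iterate (powerStep b) (b ^ L % M) Q))

  module _ (b c d₁ d₂ L P Q : ℕ) (S : Tree) where

    misses : ℕ × ℕ × ℕ → Bool
    misses (x , _ , _) = not (member ((x + d₁) % M) S)

    hits : ℕ → Bool
    hits x = member ((c * x + d₂) % M) S

    Separation : Set
    Separation = iterate perrinStep (perrinWindow 0) P ≡ perrinWindow 0
               × all misses (List.iterate perrinStep (perrinWindow 0) P) ≡ true
               × iterate (powerStep b) (b ^ L % M) Q ≡ b ^ L % M
               × all hits (List.iterate (powerStep b) (b ^ L % M) Q) ≡ true

    separation? : Dec Separation
    separation? = ≡-dec _≟_ (≡-dec _≟_ _≟_) _ _ ×-dec _ Bool.≟ true ×-dec _ ≟ _ ×-dec _ Bool.≟ true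

    separation⇒no-solution : ⦃ _ : NonZero P ⦄ ⦃ _ : NonZero Q ⦄ → Separation →
                             ∀ n k → E n + d₁ ≢ c * b ^ (k + L) + d₂
    separation⇒no-solution (perrinPeriodic , allMiss , powerPeriodic , allHit) n k eq =
      not-¬ (sym (trans (cong (λ r → member r S) same-residue) hit)) (sym miss)
      where
      miss : misses (perrinWindow n) ≡ true
      miss = subst (λ w → misses w ≡ true) (iterate-perrinStep n)
               (all-periodic-orbit perrinStep misses perrinPeriodic allMiss n)

      hit : hits (b ^ (k + L) % M) ≡ true
      hit = subst (λ x → hits x ≡ true) (iterate-powerStep b L k)
              (all-periodic-orbit (powerStep b) hits powerPeriodic allHit k)

      same-residue : (E n % M + d₁) % M ≡ (c * (b ^ (k + L) % M) + d₂) % M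
      same-residue = begin
        (E n % M + d₁) % M                   ≡⟨ [m%d+n]%d≡[m+n]%d (E n) d₁ ⟩
        (E n + d₁) % M                       ≡⟨ cong (_% M) eq ⟩
        (c * b ^ (k + L) + d₂) % M           ≡⟨ [m%d+n]%d≡[m+n]%d (c * b ^ (k + L)) d₂ ⟨
        (c * b ^ (k + L) % M + d₂) % M       ≡⟨ cong (λ x → (x + d₂) % M) ([m*[n%d]]%d≡[m*n]%d c _) ⟨
        (c * (b ^ (k + L) % M) % M + d₂) % M ≡⟨ [m%d+n]%d≡[m+n]%d (c * (b ^ (k + L) % M)) d₂ ⟩
        (c * (b ^ (k + L) % M) + d₂) % M     ∎
        where open ≡-Reasoning

open Sieve

Exceeds : ℕ → ℕ → Set
Exceeds v N = v < E N × v < E (suc N) × v < E (suc (suc N))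

exceeds? : ∀ v N → Dec (Exceeds v N)
exceeds? v N = v <? E N ×-dec v <? E (suc N) ×-dec v <? E (suc (suc N))

exceeds-suc : ∀ {v} N → Exceeds v N → Exceeds v (suc N)
exceeds-suc N (_ , v<E₁ , v<E₂) = v<E₁ , v<E₂ , <-≤-trans v<E₁ (m≤m+n (E (suc N)) (E N))

exceeds-+ : ∀ {v} N k → Exceeds v N → Exceeds v (k + N)
exceeds-+ N zero    ex = ex
exceeds-+ N (suc k) ex = exceeds-suc (k + N) (exceeds-+ N k ex)

exceeds⇒< : ∀ {v} N {n} → Exceeds v N → N ≤ n → v < E n
exceeds⇒< N {n} ex N≤n = subst (λ m → _ < E m) (m∸n+n≡m N≤n) (proj₁ (exceeds-+ N (n ∸ N) ex))

record Certificate : Set where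
  constructor certificate
  field
    threshold modulus perrinPeriod powerPeriod : ℕ
    ⦃ modulus≢0 ⦄      : NonZero modulus
    ⦃ perrinPeriod≢0 ⦄ : NonZero perrinPeriod
    ⦃ powerPeriod≢0 ⦄  : NonZero powerPeriod

-- The shifts d₁, d₂ keep truncated subtraction out of the "− 1" families.
module Search (c : ℕ → ℕ) (d₁ d₂ : ℕ)
              (Solution : ℕ → ℕ → ℕ → Set) (solution? : ∀ n b l → Dec (Solution n b l)) where

  Equation : ℕ → ℕ → ℕ → Set
  Equation n b l = E n + d₁ ≡ c b * b ^ l + d₂

  bound : ℕ
  bound = 25

  SmallCase : ℕ → ℕ → Set
  SmallCase b l = Exceeds (c b * b ^ l + d₂) bound
                × (∀ {n} → n < bound → Equation n b l → Solution n b l)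

  smallCase? : ∀ b l → Dec (SmallCase b l)
  smallCase? b l = exceeds? _ bound
                   ×-dec allUpTo? (λ n → (E n + d₁ ≟ c b * b ^ l + d₂) →-dec solution? n b l) bound

  smallCase⇒complete : ∀ {b l} → SmallCase b l → ∀ {n} → Equation n b l → Solution n b l
  smallCase⇒complete (ex , below) {n} eq with n <? bound
  ... | yes n<bound = below n<bound eq
  ... | no  n≮bound = contradiction (≤-trans (m≤m+n (E n) d₁) (≤-reflexive eq))
                                    (<⇒≱ (exceeds⇒< bound ex (≮⇒≥ n≮bound)))

  module _ (b : ℕ) (cert : Certificate) where
    open Certificate cert

    residues : Tree
    residues = residueTree modulus b (c b) d₂ threshold powerPeriod

    Certified : Set
    Certified = (∀ {l} → l < threshold → 1 ≤ l → SmallCase b l)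
              × Separation modulus b (c b) d₁ d₂ threshold perrinPeriod powerPeriod residues

    certified? : Dec Certified
    certified? = allUpTo? (λ l → 1 ≤? l →-dec smallCase? b l) threshold
                 ×-dec separation? modulus b (c b) d₁ d₂ threshold perrinPeriod powerPeriod residues

    certified⇒complete : Certified → ∀ {n l} → 1 ≤ l → Equation n b l → Solution n b l
    certified⇒complete (small , separated) {n} {l} 1≤l eq with l <? threshold
    ... | yes l<L = smallCase⇒complete (small l<L 1≤l) eq
    ... | no  l≮L = contradiction (subst (Equation n b) (sym (m∸n+n≡m (≮⇒≥ l≮L))) eq)
                      (separation⇒no-solution modulus b (c b) d₁ d₂ threshold perrinPeriod powerPeriod
                         residues separated n (l ∸ threshold))

  allCertified? : (table : ℕ → Certificate) → Dec (∀ {b} → b < 11 → 2 ≤ b → Certified b (table b))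
  allCertified? table = allUpTo? (λ b → 2 ≤? b →-dec certified? b (table b)) 11

  complete : ∀ table → isYes (allCertified? table) ≡ true →
             ∀ {n b l} → Adm b l → Equation n b l → Solution n b l
  complete table ok ((2≤b , b≤10) , 1≤l) = certified⇒complete _ (table _) (certified (s≤s b≤10) 2≤b) 1≤l
    where certified = toWitness {a? = allCertified? table} (Equivalence.from T-≡ ok)

adm? : ∀ b l → Dec (Adm b l)
adm? b l = (2 ≤? b ×-dec b ≤? 10) ×-dec 1 ≤? l

triple? : ∀ n b l n′ b′ l′ → Dec (Triple n b l n′ b′ l′)
triple? n b l n′ b′ l′ = n ≟ n′ ×-dec b ≟ b′ ×-dec l ≟ l′

m≡n∸1⇒m+1≡n+0 : ∀ {m n} → 0 < n → m ≡ n ∸ 1 → m + 1 ≡ n + 0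
m≡n∸1⇒m+1≡n+0 {n = n} n>0 refl = trans (m∸n+n≡m n>0) (sym (+-identityʳ n))

m≡n+1⇒m+0≡n+1 : ∀ {m n} → m ≡ n + 1 → m + 0 ≡ n + 1
m≡n+1⇒m+0≡n+1 {m} = trans (+-identityʳ m)

perrinValue : ∀ {F} n b l → True (adm? b l) → E n ≡ F b l → PerrinValue F (E n)
perrinValue n b l adm eq = n , b , l , toWitness adm , refl , eq

module _ {F : ℕ → ℕ → ℕ} {Solution : ℕ → ℕ → ℕ → Set}
         (complete : ∀ {n b l} → Adm b l → E n ≡ F b l → Solution n b l) where

  solutions⇔ : (∀ n b l → Solution n b l → E n ≡ F b l) →
               ∀ n b l → Adm b l → (E n ≡ F b l ⇔ Solution n b l)
  solutions⇔ sound n b l adm = mk⇔ (complete adm) (sound n b l)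

  perrinValues⇔ : {Value : ℕ → Set} →
                  (∀ n b l → Solution n b l → Value (E n)) →
                  (∀ {m} → Value m → PerrinValue F m) →
                  ∀ m → PerrinValue F m ⇔ Value m
  perrinValues⇔ value witness m =
    mk⇔ (λ { (n , b , l , adm , refl , eq) → value n b l (complete adm eq) }) witness

Thabit₁Solution : ℕ → ℕ → ℕ → Set
Thabit₁Solution n b l = Triple n b l 5 2 1 ⊎ Triple n b l 6 2 1 ⊎ Triple n b l 12 5 1

module Thabit₁ = Search (_+ 1) 1 0 Thabit₁Solution
  (λ n b l → triple? n b l 5 2 1 ⊎-dec triple? n b l 6 2 1 ⊎-dec triple? n b l 12 5 1)

-- Only the bases 2 … 10 are consulted; the last clause is a placeholder.
thabit₁-certificates : ℕ → Certificate
thabit₁-certificates 2  = certificate 8 114944 896 224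
thabit₁-certificates 3  = certificate 2 20160 8736 48
thabit₁-certificates 4  = certificate 4 8960 2688 6
thabit₁-certificates 5  = certificate 2 275 120 5
thabit₁-certificates 6  = certificate 3 1080 6552 1
thabit₁-certificates 7  = certificate 1 280 336 4
thabit₁-certificates 8  = certificate 3 4480 1344 4
thabit₁-certificates 9  = certificate 1 5040 4368 6
thabit₁-certificates 10 = certificate 2 10100 4200 4
thabit₁-certificates _  = certificate 1 1 1 1

thabit₁-complete : ∀ {n b l} → Adm b l → E n ≡ thabit₁ b l → Thabit₁Solution n b l
thabit₁-complete {b = b} {l} adm@((s≤s (s≤s z≤n) , _) , _) eq =
  Thabit₁.complete thabit₁-certificates refl adm
    (m≡n∸1⇒m+1≡n+0 (<-≤-trans (m^n>0 b l) (m≤n*m (b ^ l) (b + 1))) eq)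

thabit₁-sound : ∀ n b l → Thabit₁Solution n b l → E n ≡ thabit₁ b l
thabit₁-sound _ _ _ (inj₁ (refl , refl , refl))        = refl
thabit₁-sound _ _ _ (inj₂ (inj₁ (refl , refl , refl))) = refl
thabit₁-sound _ _ _ (inj₂ (inj₂ (refl , refl , refl))) = refl

thabit₁-value : ∀ n b l → Thabit₁Solution n b l → E n ≡ 5 ⊎ E n ≡ 29
thabit₁-value _ _ _ (inj₁ (refl , refl , refl))        = inj₁ refl
thabit₁-value _ _ _ (inj₂ (inj₁ (refl , refl , refl))) = inj₁ refl
thabit₁-value _ _ _ (inj₂ (inj₂ (refl , refl , refl))) = inj₂ refl

thabit₁-witness : ∀ {m} → m ≡ 5 ⊎ m ≡ 29 → PerrinValue thabit₁ m
thabit₁-witness (inj₁ refl) = perrinValue 5 2 1 _ refl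
thabit₁-witness (inj₂ refl) = perrinValue 12 5 1 _ refl

Thabit₂Solution : ℕ → ℕ → ℕ → Set
Thabit₂Solution n b l = Triple n b l 7 2 1

module Thabit₂ = Search (_+ 1) 0 1 Thabit₂Solution (λ n b l → triple? n b l 7 2 1)

thabit₂-certificates : ℕ → Certificate
thabit₂-certificates 2  = certificate 5 236320 1680 420
thabit₂-certificates 3  = certificate 4 241461 14040 30
thabit₂-certificates 4  = certificate 3 1120 336 6
thabit₂-certificates 5  = certificate 1 40 168 2
thabit₂-certificates 6  = certificate 2 180 2184 1
thabit₂-certificates 7  = certificate 2 784 336 2
thabit₂-certificates 8  = certificate 2 448 672 1
thabit₂-certificates 9  = certificate 1 720 2184 2
thabit₂-certificates 10 = certificate 2 10100 4200 4
thabit₂-certificates _  = certificate 1 1 1 1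

thabit₂-complete : ∀ {n b l} → Adm b l → E n ≡ thabit₂ b l → Thabit₂Solution n b l
thabit₂-complete adm eq = Thabit₂.complete thabit₂-certificates refl adm (m≡n+1⇒m+0≡n+1 eq)

thabit₂-sound : ∀ n b l → Thabit₂Solution n b l → E n ≡ thabit₂ b l
thabit₂-sound _ _ _ (refl , refl , refl) = refl

thabit₂-value : ∀ n b l → Thabit₂Solution n b l → E n ≡ 7
thabit₂-value _ _ _ (refl , refl , refl) = refl

thabit₂-witness : ∀ {m} → m ≡ 7 → PerrinValue thabit₂ m
thabit₂-witness refl = perrinValue 7 2 1 _ refl

Williams₁Solution : ℕ → ℕ → ℕ → Set
Williams₁Solution n b l = Triple n b l 0 2 2 ⊎ Triple n b l 3 2 2 ⊎ Triple n b l 5 3 1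
  ⊎ Triple n b l 6 3 1 ⊎ Triple n b l 7 2 3 ⊎ Triple n b l 10 3 2 ⊎ Triple n b l 12 6 1

module Williams₁ = Search (_∸ 1) 1 0 Williams₁Solution
  (λ n b l → triple? n b l 0 2 2 ⊎-dec triple? n b l 3 2 2 ⊎-dec triple? n b l 5 3 1
    ⊎-dec triple? n b l 6 3 1 ⊎-dec triple? n b l 7 2 3 ⊎-dec triple? n b l 10 3 2
    ⊎-dec triple? n b l 12 6 1)

williams₁-certificates : ℕ → Certificate
williams₁-certificates 2  = certificate 8 114944 896 224
williams₁-certificates 3  = certificate 6 3840744519 252720 270
williams₁-certificates 4  = certificate 4 114944 896 112
williams₁-certificates 5  = certificate 2 275 120 5
williams₁-certificates 6  = certificate 4 2404080 39312 26
williams₁-certificates 7  = certificate 2 3920 336 4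
williams₁-certificates 8  = certificate 2 3136 672 7
williams₁-certificates 9  = certificate 2 171720 19656 26
williams₁-certificates 10 = certificate 2 1100 840 2
williams₁-certificates _  = certificate 1 1 1 1

williams₁-complete : ∀ {n b l} → Adm b l → E n ≡ williams₁ b l → Williams₁Solution n b l
williams₁-complete {b = b} {l} adm@((s≤s (s≤s z≤n) , _) , _) eq =
  Williams₁.complete williams₁-certificates refl adm
    (m≡n∸1⇒m+1≡n+0 (<-≤-trans (m^n>0 b l) (m≤n*m (b ^ l) (b ∸ 1))) eq)

williams₁-sound : ∀ n b l → Williams₁Solution n b l → E n ≡ williams₁ b l
williams₁-sound _ _ _ (inj₁ (refl , refl , refl))                                        = refl
williams₁-sound _ _ _ (inj₂ (inj₁ (refl , refl , refl)))                                 = refl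
williams₁-sound _ _ _ (inj₂ (inj₂ (inj₁ (refl , refl , refl))))                          = refl
williams₁-sound _ _ _ (inj₂ (inj₂ (inj₂ (inj₁ (refl , refl , refl)))))                   = refl
williams₁-sound _ _ _ (inj₂ (inj₂ (inj₂ (inj₂ (inj₁ (refl , refl , refl))))))            = refl
williams₁-sound _ _ _ (inj₂ (inj₂ (inj₂ (inj₂ (inj₂ (inj₁ (refl , refl , refl)))))))     = refl
williams₁-sound _ _ _ (inj₂ (inj₂ (inj₂ (inj₂ (inj₂ (inj₂ (refl , refl , refl)))))))     = refl

williams₁-value : ∀ n b l → Williams₁Solution n b l →
                  E n ≡ 3 ⊎ E n ≡ 5 ⊎ E n ≡ 7 ⊎ E n ≡ 17 ⊎ E n ≡ 29
williams₁-value _ _ _ (inj₁ (refl , refl , refl))                                    = inj₁ refl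
williams₁-value _ _ _ (inj₂ (inj₁ (refl , refl , refl)))                             = inj₁ refl
williams₁-value _ _ _ (inj₂ (inj₂ (inj₁ (refl , refl , refl))))                      = inj₂ (inj₁ refl)
williams₁-value _ _ _ (inj₂ (inj₂ (inj₂ (inj₁ (refl , refl , refl)))))               = inj₂ (inj₁ refl)
williams₁-value _ _ _ (inj₂ (inj₂ (inj₂ (inj₂ (inj₁ (refl , refl , refl))))))        = inj₂ (inj₂ (inj₁ refl))
williams₁-value _ _ _ (inj₂ (inj₂ (inj₂ (inj₂ (inj₂ (inj₁ (refl , refl , refl))))))) = inj₂ (inj₂ (inj₂ (inj₁ refl)))
williams₁-value _ _ _ (inj₂ (inj₂ (inj₂ (inj₂ (inj₂ (inj₂ (refl , refl , refl))))))) = inj₂ (inj₂ (inj₂ (inj₂ refl)))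

williams₁-witness : ∀ {m} → m ≡ 3 ⊎ m ≡ 5 ⊎ m ≡ 7 ⊎ m ≡ 17 ⊎ m ≡ 29 → PerrinValue williams₁ m
williams₁-witness (inj₁ refl)                      = perrinValue 0 2 2 _ refl
williams₁-witness (inj₂ (inj₁ refl))               = perrinValue 5 3 1 _ refl
williams₁-witness (inj₂ (inj₂ (inj₁ refl)))        = perrinValue 7 2 3 _ refl
williams₁-witness (inj₂ (inj₂ (inj₂ (inj₁ refl)))) = perrinValue 10 3 2 _ refl
williams₁-witness (inj₂ (inj₂ (inj₂ (inj₂ refl)))) = perrinValue 12 6 1 _ refl

Williams₂Solution : ℕ → ℕ → ℕ → Set
Williams₂Solution n b l = Triple n b l 0 2 1 ⊎ Triple n b l 3 2 1 ⊎ Triple n b l 5 2 2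
  ⊎ Triple n b l 6 2 2 ⊎ Triple n b l 7 3 1 ⊎ Triple n b l 10 2 4

module Williams₂ = Search (_∸ 1) 0 1 Williams₂Solution
  (λ n b l → triple? n b l 0 2 1 ⊎-dec triple? n b l 3 2 1 ⊎-dec triple? n b l 5 2 2
    ⊎-dec triple? n b l 6 2 2 ⊎-dec triple? n b l 7 3 1 ⊎-dec triple? n b l 10 2 4)

williams₂-certificates : ℕ → Certificate
williams₂-certificates 2  = certificate 6 28736 224 224
williams₂-certificates 3  = certificate 3 283689 9360 234
williams₂-certificates 4  = certificate 3 134848 7392 21
williams₂-certificates 5  = certificate 2 275 120 5
williams₂-certificates 6  = certificate 4 343440 19656 26
williams₂-certificates 7  = certificate 2 784 336 2
williams₂-certificates 8  = certificate 1 392 336 7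
williams₂-certificates 9  = certificate 1 315 624 6
williams₂-certificates 10 = certificate 1 110 840 2
williams₂-certificates _  = certificate 1 1 1 1

williams₂-complete : ∀ {n b l} → Adm b l → E n ≡ williams₂ b l → Williams₂Solution n b l
williams₂-complete adm eq = Williams₂.complete williams₂-certificates refl adm (m≡n+1⇒m+0≡n+1 eq)

williams₂-sound : ∀ n b l → Williams₂Solution n b l → E n ≡ williams₂ b l
williams₂-sound _ _ _ (inj₁ (refl , refl , refl))                                = refl
williams₂-sound _ _ _ (inj₂ (inj₁ (refl , refl , refl)))                         = refl
williams₂-sound _ _ _ (inj₂ (inj₂ (inj₁ (refl , refl , refl))))                  = refl
williams₂-sound _ _ _ (inj₂ (inj₂ (inj₂ (inj₁ (refl , refl , refl)))))           = refl
williams₂-sound _ _ _ (inj₂ (inj₂ (inj₂ (inj₂ (inj₁ (refl , refl , refl))))))    = refl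
williams₂-sound _ _ _ (inj₂ (inj₂ (inj₂ (inj₂ (inj₂ (refl , refl , refl))))))    = refl

williams₂-value : ∀ n b l → Williams₂Solution n b l → E n ≡ 3 ⊎ E n ≡ 5 ⊎ E n ≡ 7 ⊎ E n ≡ 17
williams₂-value _ _ _ (inj₁ (refl , refl , refl))                             = inj₁ refl
williams₂-value _ _ _ (inj₂ (inj₁ (refl , refl , refl)))                      = inj₁ refl
williams₂-value _ _ _ (inj₂ (inj₂ (inj₁ (refl , refl , refl))))               = inj₂ (inj₁ refl)
williams₂-value _ _ _ (inj₂ (inj₂ (inj₂ (inj₁ (refl , refl , refl)))))        = inj₂ (inj₁ refl)
williams₂-value _ _ _ (inj₂ (inj₂ (inj₂ (inj₂ (inj₁ (refl , refl , refl)))))) = inj₂ (inj₂ (inj₁ refl))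
williams₂-value _ _ _ (inj₂ (inj₂ (inj₂ (inj₂ (inj₂ (refl , refl , refl)))))) = inj₂ (inj₂ (inj₂ refl))

williams₂-witness : ∀ {m} → m ≡ 3 ⊎ m ≡ 5 ⊎ m ≡ 7 ⊎ m ≡ 17 → PerrinValue williams₂ m
williams₂-witness (inj₁ refl)               = perrinValue 0 2 1 _ refl
williams₂-witness (inj₂ (inj₁ refl))        = perrinValue 5 2 2 _ refl
williams₂-witness (inj₂ (inj₂ (inj₁ refl))) = perrinValue 7 3 1 _ refl
williams₂-witness (inj₂ (inj₂ (inj₂ refl))) = perrinValue 10 2 4 _ refl

theorem4p1 : ((n b l : ℕ) → Adm b l →
      (E n ≡ thabit₁ b l ⇔
        (Triple n b l 5 2 1 ⊎ Triple n b l 6 2 1 ⊎ Triple n b l 12 5 1)))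
    × ((m : ℕ) → PerrinValue thabit₁ m ⇔ (m ≡ 5 ⊎ m ≡ 29))
    × ((n b l : ℕ) → Adm b l →
      (E n ≡ thabit₂ b l ⇔ Triple n b l 7 2 1))
    × ((m : ℕ) → PerrinValue thabit₂ m ⇔ m ≡ 7)
    × ((n b l : ℕ) → Adm b l →
      (E n ≡ williams₁ b l ⇔
        (Triple n b l 0 2 2 ⊎ Triple n b l 3 2 2 ⊎ Triple n b l 5 3 1
          ⊎ Triple n b l 6 3 1 ⊎ Triple n b l 7 2 3 ⊎ Triple n b l 10 3 2
          ⊎ Triple n b l 12 6 1)))
    × ((m : ℕ) → PerrinValue williams₁ m ⇔
        (m ≡ 3 ⊎ m ≡ 5 ⊎ m ≡ 7 ⊎ m ≡ 17 ⊎ m ≡ 29))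
    × ((n b l : ℕ) → Adm b l →
      (E n ≡ williams₂ b l ⇔
        (Triple n b l 0 2 1 ⊎ Triple n b l 3 2 1 ⊎ Triple n b l 5 2 2
          ⊎ Triple n b l 6 2 2 ⊎ Triple n b l 7 3 1 ⊎ Triple n b l 10 2 4)))
    × ((m : ℕ) → PerrinValue williams₂ m ⇔ (m ≡ 3 ⊎ m ≡ 5 ⊎ m ≡ 7 ⊎ m ≡ 17))
theorem4p1 =
    solutions⇔ thabit₁-complete thabit₁-sound
  , perrinValues⇔ thabit₁-complete thabit₁-value thabit₁-witness
  , solutions⇔ thabit₂-complete thabit₂-sound
  , perrinValues⇔ thabit₂-complete thabit₂-value thabit₂-witness
  , solutions⇔ williams₁-complete williams₁-sound
  , perrinValues⇔ williams₁-complete williams₁-value williams₁-witness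
  , solutions⇔ williams₂-complete williams₂-sound
  , perrinValues⇔ williams₂-complete williams₂-value williams₂-witness
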